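{- Let $\mathcal C$ be a set of frame conditions. For every context $\mathcal G\{\}$, all terms $t,s$, every variable $z$ and every formula $\phi$, the nested sequents $\mathcal G\{t=t\}$ and $\mathcal G\{t\neq s,\phi(t/z),\overline{\phi}(s/z)\}$ are provable in $\mathsf{N}\mathsf{Q}^{\circ}_{=}.\mathsf{K}(\mathcal{C})$.
   Context: Syntax. Terms are variables or constants. Formulas (negation normal form): $\phi ::= P(\vec t)\mid \neg P(\vec t)\mid t=s\mid t\neq s\mid \phi\lor\phi\mid\phi\land\phi\mid\exists x\phi\mid\forall x\phi\mid\Diamond\phi\mid\Box\phi$ ($P$ an $n$-ary predicate, $n\ge 0$). A literal is $P(\vec t)$, $\neg P(\vec t)$, $t=s$ or $t\neq s$; a negative literal is $\neg P(\vec t)$ or $t\neq s$. The negation $\overline{\phi}$ swaps $P(\vec t)/\neg P(\vec t)$, $=/\neq$, $\lor/\land$, $\exists/\forall$, $\Diamond/\Box$ (De Morgan duals). $\phi(t/x)$ is capture-avoiding substitution for free occurrences; formulas differing only in bound variable names are identified. Frames. A frame is $\langle W,R,U,D\rangle$ with $W\neq\emptyset$, $R\subseteq W\times W$, $U\neq\emptyset$ and $D_w\subseteq U$ for each $w\in W$. Frame conditions: $\mathbf D$: every $w$ has some $u$ with $wRu$; $\mathbf G(n,k)$ ($n,k\in\mathbb N$): $wR^nu$ and $wR^kv$ imply $uRv$ ($R^0$ = identity); $\mathbf{ID}$: $wRv\Rightarrow D_w\subseteq D_v$; $\mathbf{DD}$: $wRv\Rightarrow D_v\subseteq D_w$; $\mathbf{CD}$: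 $D_w=U$ for all $w$; $\mathbf{NE}$: $D_w\neq\emptyset$ for all $w$. $\mathcal C$ is a set of such conditions, assumed closed: if one of these conditions holds on every frame satisfying all of $\mathcal C$, it belongs to $\mathcal C$. $\mathbf G$ denotes the set of all $\mathbf G(n,k)\in\mathcal C$. Grammars. Characters $\mathsf f$, $\mathsf b$. A $\Sigma$-system $S$ is a set of productions $c\to s$, $c\in\{\mathsf f,\mathsf b\}$, $s$ a string over $\{\mathsf f,\mathsf b\}$; $s'cr'\to s'sr'$ is a one-step derivation, $\to^*_S$ its reflexive-transitive closure, $L_S(s)=\{t: s\to^*_S t\}$. $S(\mathbf G)$ contains $\mathsf f\to\mathsf b^n\mathsf f^k$ and $\mathsf b\to\mathsf b^k\mathsf f^n$ for each $\mathbf G(n,k)\in\mathbf G$; $S4=\{\mathsf f\to\varepsilon,\mathsf b\to\varepsilon,\mathsf f\to\mathsf f\mathsf f,\mathsf b\to\mathsf b\mathsf b\}$; $S5=\{\mathsf f\to\varepsilon,\mathsf b\to\varepsilon,\mathsf f\to\mathsf b\mathsf f,\mathsf b\to\mathsf b\mathsf f\}$. Nested sequents. A flat sequent is $\vec t,\vec\phi$: a finite multiset $\vec t$ of terms (signature) and a finite multiset $\vec\phi$ of formulas. A nested sequent is $\Gamma,[\mathcal H_1],\dots,[\mathcal H_n]$ ($n\ge 0$) with $\Gamma$ flat and $\mathcal H_i$ nested sequents; it is a tree of flat sequents (components), each with a unique name, $\Gamma$ being the root and the roots of the $\mathcal H_i$ its children. A context $\mathcal G\{\}$ has a hole in a component;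 $\mathcal G\{\mathcal H\}$ fills it, $\mathcal G\{\emptyset\}$ removes it; $\mathcal G\{\cdot\}_{w}\{\cdot\}_{u}$ indicates holes in the components named $w,u$. Propagation: for each parent $w$ and child $u$ we have $w\xrightarrow{\mathsf f}u$ and $u\xrightarrow{\mathsf b}w$; $w\xrightarrow{c_1\cdots c_m}u$ means there are components $w=v_0,\dots,v_m=u$ with $v_{i-1}\xrightarrow{c_i}v_i$ ($w=u$ for the empty string); $w\xrightarrow{L}u$ means $w\xrightarrow{s}u$ for some $s\in L$. Calculus. Rules (premises $\Rightarrow$ conclusion): (ax) $\Rightarrow\mathcal G\{L,\overline L\}$, $L$ a literal; ($\lor$) $\mathcal G\{\phi,\psi\}\Rightarrow\mathcal G\{\phi\lor\psi\}$; ($\land$) $\mathcal G\{\phi\}$, $\mathcal G\{\psi\}\Rightarrow\mathcal G\{\phi\land\psi\}$; ($\exists$) $\mathcal G\{t,\exists x\psi,\psi(t/x)\}\Rightarrow\mathcal G\{t,\exists x\psi\}$; ($\forall$) $\mathcal G\{y,\phi(y/x)\}\Rightarrow\mathcal G\{\forall x\phi\}$, $y$ a variable not free in the conclusion; ($\Diamond$) $\mathcal G\{\Diamond\phi\}_w\{\phi\}_u\Rightarrow\mathcal G\{\Diamond\phi\}_w\{\emptyset\}_u$ provided $w\xrightarrow{L}u$, $L=L_{S(\mathbf G)}(\mathsf f)$; ($\Box$) $\mathcal G\{[\phi]\}\Rightarrow\mathcal G\{\Box\phi\}$; (ref) $\mathcal G\{t\neq t\}\Rightarrow\mathcal G\{\emptyset\}$;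 (rep) $\mathcal G\{t\neq s,N(t/z),N(s/z)\}\Rightarrow\mathcal G\{t\neq s,N(t/z)\}$, $N$ a negative literal; (drep) $\mathcal G\{s,t,t\neq s\}\Rightarrow\mathcal G\{t,t\neq s\}$; (rig) $\mathcal G\{s\neq t\}_w\{s\neq t\}_u\Rightarrow\mathcal G\{s\neq t\}_w\{\emptyset\}_u$, $w\neq u$; (dp) $\mathcal G\{t\}_w\{t\}_u\Rightarrow\mathcal G\{t\}_w\{\emptyset\}_u$, $w\neq u$, $w\xrightarrow{L}u$ with $L=L_{S4\cup S(\mathbf G)}(\mathsf f)$ if $\mathbf{ID}\in\mathcal C,\mathbf{DD}\notin\mathcal C$, $L=L_{S4\cup S(\mathbf G)}(\mathsf b)$ if $\mathbf{DD}\in\mathcal C,\mathbf{ID}\notin\mathcal C$, $L=L_{S5}(\mathsf f)$ if both; (d) $\mathcal G\{[\emptyset]\}\Rightarrow\mathcal G\{\emptyset\}$; (nd) $\mathcal G\{y\}\Rightarrow\mathcal G\{\emptyset\}$, $y$ a variable not free in the conclusion; (cd) $\mathcal G\{t\}\Rightarrow\mathcal G\{\emptyset\}$. $\mathsf N\mathsf Q^\circ_=.\mathsf K(\mathcal C)$ consists of ax, $\lor$, $\land$, $\exists$, $\forall$, $\Diamond$, $\Box$, ref, rep, drep, rig, plus dp iff $\mathcal C\cap\{\mathbf{ID},\mathbf{DD}\}\neq\emptyset$, nd iff $\mathbf{NE}\in\mathcal C$, cd iff $\mathbf{CD}\in\mathcal C$, d iff $\mathbf D\in\mathcal C$. A proof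 is a finite tree of nested sequents whose nodes are conclusions of rule instances with their children as premises and whose leaves are ax instances. -}

module Defs where

open import Data.Nat using (ℕ; zero; suc)
open import Data.Nat as ℕ using ()
open import Data.Fin using (Fin; zero; suc)
open import Data.List using (List; []; _∷_; _++_; replicate)
open import Data.List.Relation.Unary.Any using (Any)
open import Data.List.Relation.Binary.Permutation.Propositional using (_↭_)
open import Data.List.Relation.Binary.Permutation.Homogeneous using (Permutation)
open import Data.Product using (Σ; ∃; _×_; _,_)
open import Data.Sum using (_⊎_)
open import Data.Empty using (⊥)
open import Data.Unit using (⊤)
open import Relation.Nullary using (¬_; yes; no)
open import Relation.Binary.PropositionalEquality using (_≡_; _≢_)
open import Relation.Binary.Construct.Closure.ReflexiveTransitive using (Star)

-- Syntax (locally nameless: bound variables are de Bruijn indices,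
-- so formulas differing only in bound variable names are identical)

data Term : Set where
  var : ℕ → Term
  con : ℕ → Term

data Tm (n : ℕ) : Set where
  bnd : Fin n → Tm n     -- bound variable (zero = innermost binder)
  tm  : Term → Tm n

-- Formulas in negation normal form, with n pending bound variables.
-- Predicates: name ℕ applied to a list of arguments.
data Formula (n : ℕ) : Set where
  atom  : ℕ → List (Tm n) → Formula n
  natom : ℕ → List (Tm n) → Formula n
  eq    : Tm n → Tm n → Formula n
  neq   : Tm n → Tm n → Formula n
  or    : Formula n → Formula n → Formula n
  and   : Formula n → Formula n → Formula n
  ex    : Formula (suc n) → Formula n
  all   : Formula (suc n) → Formula n
  dia   : Formula n → Formula n
  box   : Formula n → Formula n

Fml : Set
Fml = Formula 0

neg : ∀ {n} → Formula n → Formula n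
neg (atom P ts) = natom P ts
neg (natom P ts) = atom P ts
neg (eq t s) = neq t s
neg (neq t s) = eq t s
neg (or φ ψ) = and (neg φ) (neg ψ)
neg (and φ ψ) = or (neg φ) (neg ψ)
neg (ex φ) = all (neg φ)
neg (all φ) = ex (neg φ)
neg (dia φ) = box (neg φ)
neg (box φ) = dia (neg φ)

data IsLit {n : ℕ} : Formula n → Set where
  lit-atom  : ∀ P ts → IsLit (atom P ts)
  lit-natom : ∀ P ts → IsLit (natom P ts)
  lit-eq    : ∀ t s → IsLit (eq t s)
  lit-neq   : ∀ t s → IsLit (neq t s)

data IsNegLit {n : ℕ} : Formula n → Set where
  nlit-natom : ∀ P ts → IsNegLit (natom P ts)
  nlit-neq   : ∀ t s → IsNegLit (neq t s)

wkTm : ∀ {n} → Tm n → Tm (suc n)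
wkTm (bnd i) = bnd (suc i)
wkTm (tm t) = tm t

ext : ∀ {m n} → (Fin m → Tm n) → Fin (suc m) → Tm (suc n)
ext σ zero = bnd zero
ext σ (suc i) = wkTm (σ i)

subTm : ∀ {m n} → (Fin m → Tm n) → Tm m → Tm n
subTm σ (bnd i) = σ i
subTm σ (tm t) = tm t

subTms : ∀ {m n} → (Fin m → Tm n) → List (Tm m) → List (Tm n)
subTms σ [] = []
subTms σ (t ∷ ts) = subTm σ t ∷ subTms σ ts

subB : ∀ {m n} → (Fin m → Tm n) → Formula m → Formula n
subB σ (atom P ts) = atom P (subTms σ ts)
subB σ (natom P ts) = natom P (subTms σ ts)
subB σ (eq t s) = eq (subTm σ t) (subTm σ s)
subB σ (neq t s) = neq (subTm σ t) (subTm σ s)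
subB σ (or φ ψ) = or (subB σ φ) (subB σ ψ)
subB σ (and φ ψ) = and (subB σ φ) (subB σ ψ)
subB σ (ex φ) = ex (subB (ext σ) φ)
subB σ (all φ) = all (subB (ext σ) φ)
subB σ (dia φ) = dia (subB σ φ)
subB σ (box φ) = box (subB σ φ)

inst : Formula 1 → Term → Fml
inst ψ t = subB (λ { zero → tm t ; (suc ()) }) ψ

-- Substitution of a term t for the free variable z: φ(t/z)
-- (capture is impossible since bound variables are indices)
fsubTm : ∀ {n} → ℕ → Term → Tm n → Tm n
fsubTm z t (bnd i) = bnd i
fsubTm z t (tm (var y)) with y ℕ.≟ z
... | yes _ = tm t
... | no _ = tm (var y)
fsubTm z t (tm (con c)) = tm (con c)

fsubTms : ∀ {n} → ℕ → Term → List (Tm n) → List (Tm n)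
fsubTms z t [] = []
fsubTms z t (a ∷ as) = fsubTm z t a ∷ fsubTms z t as

fsub : ∀ {n} → ℕ → Term → Formula n → Formula n
fsub z t (atom P ts) = atom P (fsubTms z t ts)
fsub z t (natom P ts) = natom P (fsubTms z t ts)
fsub z t (eq a c) = eq (fsubTm z t a) (fsubTm z t c)
fsub z t (neq a c) = neq (fsubTm z t a) (fsubTm z t c)
fsub z t (or φ ψ) = or (fsub z t φ) (fsub z t ψ)
fsub z t (and φ ψ) = and (fsub z t φ) (fsub z t ψ)
fsub z t (ex φ) = ex (fsub z t φ)
fsub z t (all φ) = all (fsub z t φ)
fsub z t (dia φ) = dia (fsub z t φ)
fsub z t (box φ) = box (fsub z t φ)

-- Occurrence of variable y (all variable occurrences are free occurrences)
OccTerm : ℕ → Term → Set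
OccTerm y (var x) = x ≡ y
OccTerm y (con c) = ⊥

OccTm : ∀ {n} → ℕ → Tm n → Set
OccTm y (bnd i) = ⊥
OccTm y (tm t) = OccTerm y t

OccF : ∀ {n} → ℕ → Formula n → Set
OccF y (atom P ts) = Any (OccTm y) ts
OccF y (natom P ts) = Any (OccTm y) ts
OccF y (eq t s) = OccTm y t ⊎ OccTm y s
OccF y (neq t s) = OccTm y t ⊎ OccTm y s
OccF y (or φ ψ) = OccF y φ ⊎ OccF y ψ
OccF y (and φ ψ) = OccF y φ ⊎ OccF y ψ
OccF y (ex φ) = OccF y φ
OccF y (all φ) = OccF y φ
OccF y (dia φ) = OccF y φ
OccF y (box φ) = OccF y φ

-- Nested sequents: a tree of flat sequents (signature, formulas)

data NSeq : Set where
  node : List Term → List Fml → List NSeq → NSeq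

-- identification of multisets (at every component, including children)
data _≈_ : NSeq → NSeq → Set where
  node : ∀ {ts ts' fs fs' cs cs'} → ts ↭ ts' → fs ↭ fs' →
         Permutation _≈_ cs cs' → node ts fs cs ≈ node ts' fs' cs'

data Occ (y : ℕ) : NSeq → Set where
  occ-sig : ∀ {ts fs cs} → Any (OccTerm y) ts → Occ y (node ts fs cs)
  occ-fml : ∀ {ts fs cs} → Any (OccF y) fs → Occ y (node ts fs cs)
  occ-sub : ∀ {ts fs cs} → Any (Occ y) cs → Occ y (node ts fs cs)

-- Component names: paths of child indices from the root
Path : Set
Path = List ℕ

mutual
  data Valid : NSeq → Path → Set where
    here  : ∀ {Γ} → Valid Γ []
    there : ∀ {ts fs cs i p} → ValidIn cs i p → Valid (node ts fs cs) (i ∷ p)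

  data ValidIn : List NSeq → ℕ → Path → Set where
    vzero : ∀ {c cs p} → Valid c p → ValidIn (c ∷ cs) zero p
    vsuc  : ∀ {c cs i p} → ValidIn cs i p → ValidIn (c ∷ cs) (suc i) p

mutual
  modAt : Path → (NSeq → NSeq) → NSeq → NSeq
  modAt [] g Γ = g Γ
  modAt (i ∷ p) g (node ts fs cs) = node ts fs (modIn i p g cs)

  modIn : ℕ → Path → (NSeq → NSeq) → List NSeq → List NSeq
  modIn i p g [] = []
  modIn zero p g (c ∷ cs) = modAt p g c ∷ cs
  modIn (suc i) p g (c ∷ cs) = c ∷ modIn i p g cs

addF : Path → List Fml → NSeq → NSeq
addF p φs = modAt p (λ { (node ts fs cs) → node ts (φs ++ fs) cs })

addT : Path → Term → NSeq → NSeq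
addT p t = modAt p (λ { (node ts fs cs) → node (t ∷ ts) fs cs })

addC : Path → NSeq → NSeq → NSeq
addC p H = modAt p (λ { (node ts fs cs) → node ts fs (H ∷ cs) })

-- A context G{ } : a nested sequent with a hole in an existing component
record Ctx : Set where
  constructor ctx
  field
    base  : NSeq
    hole  : Path
    valid : Valid base hole

_⟦_⟧ : Ctx → List Fml → NSeq
ctx Γ w _ ⟦ φs ⟧ = addF w φs Γ

data Chr : Set where
  cf cb : Chr

-- a Σ-system as a predicate on productions c → s
Prods : Set₁
Prods = Chr → List Chr → Set

data Step (S : Prods) : List Chr → List Chr → Set where
  step : ∀ {c r} (x y : List Chr) → S c r → Step S (x ++ c ∷ y) (x ++ r ++ y)

Lang : Prods → Chr → List Chr → Set
Lang S c t = Star (Step S) (c ∷ []) t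

_∪P_ : Prods → Prods → Prods
(S ∪P T) c r = S c r ⊎ T c r

data S4 : Prods where
  s4-eps : ∀ c → S4 c []
  s4-dbl : ∀ c → S4 c (c ∷ c ∷ [])

data S5 : Prods where
  s5-eps : ∀ c → S5 c []
  s5-f   : S5 cf (cb ∷ cf ∷ [])
  s5-b   : S5 cb (cb ∷ cf ∷ [])

data Cond : Set where
  D  : Cond
  G  : ℕ → ℕ → Cond
  ID DD CD NE : Cond

record Frame : Set₁ where
  field
    W   : Set
    R   : W → W → Set
    U   : Set
    Dom : W → U → Set      -- D_w ⊆ U as a predicate
    w₀  : W                -- W ≠ ∅
    u₀  : U                -- U ≠ ∅

Rpow : (F : Frame) → ℕ → Frame.W F → Frame.W F → Set
Rpow F zero w u = w ≡ u
Rpow F (suc n) w u = ∃ λ v → Frame.R F w v × Rpow F n v u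

Holds : Frame → Cond → Set
Holds F D = ∀ w → ∃ λ u → R w u where open Frame F
Holds F (G n k) = ∀ w u v → Rpow F n w u → Rpow F k w v → Frame.R F u v
Holds F ID = ∀ w v → R w v → ∀ x → Dom w x → Dom v x where open Frame F
Holds F DD = ∀ w v → R w v → ∀ x → Dom v x → Dom w x where open Frame F
Holds F CD = ∀ w x → Dom w x where open Frame F
Holds F NE = ∀ w → ∃ λ x → Dom w x where open Frame F

CondSet : Set₁
CondSet = Cond → Set

Closed : CondSet → Set₁
Closed C = ∀ c → (∀ (F : Frame) → (∀ c' → C c' → Holds F c') → Holds F c) → C c

data SG (C : CondSet) : Prods where
  sg-f : ∀ {n k} → C (G n k) → SG C cf (replicate n cb ++ replicate k cf)
  sg-b : ∀ {n k} → C (G n k) → SG C cb (replicate k cb ++ replicate n cf)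

data PropG (Γ : NSeq) : Path → List Chr → Path → Set where
  pnil : ∀ {w} → PropG Γ w [] w
  pf   : ∀ {w u v i s} → v ≡ w ++ i ∷ [] → Valid Γ v →
         PropG Γ v s u → PropG Γ w (cf ∷ s) u
  pb   : ∀ {w u v i s} → w ≡ v ++ i ∷ [] → Valid Γ w →
         PropG Γ v s u → PropG Γ w (cb ∷ s) u

Reach : Prods → Chr → NSeq → Path → Path → Set
Reach S c Γ w u = ∃ λ s → Lang S c s × PropG Γ w s u

data Prf (C : CondSet) : NSeq → Set where
  perm : ∀ {Γ Δ} → Γ ≈ Δ → Prf C Δ → Prf C Γ
  ax   : ∀ {Γ w L} → Valid Γ w → IsLit L → Prf C (addF w (L ∷ neg L ∷ []) Γ)
  r∨   : ∀ {Γ w φ ψ} → Valid Γ w →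
         Prf C (addF w (φ ∷ ψ ∷ []) Γ) → Prf C (addF w (or φ ψ ∷ []) Γ)
  r∧   : ∀ {Γ w φ ψ} → Valid Γ w →
         Prf C (addF w (φ ∷ []) Γ) → Prf C (addF w (ψ ∷ []) Γ) →
         Prf C (addF w (and φ ψ ∷ []) Γ)
  r∃   : ∀ {Γ w t ψ} → Valid Γ w →
         Prf C (addT w t (addF w (ex ψ ∷ inst ψ t ∷ []) Γ)) →
         Prf C (addT w t (addF w (ex ψ ∷ []) Γ))
  r∀   : ∀ {Γ w y φ} → Valid Γ w → ¬ Occ y (addF w (all φ ∷ []) Γ) →
         Prf C (addT w (var y) (addF w (inst φ (var y) ∷ []) Γ)) →
         Prf C (addF w (all φ ∷ []) Γ)
  r◇   : ∀ {Γ w u φ} → Valid Γ w → Valid Γ u → Reach (SG C) cf Γ w u →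
         Prf C (addF u (φ ∷ []) (addF w (dia φ ∷ []) Γ)) →
         Prf C (addF w (dia φ ∷ []) Γ)
  r□   : ∀ {Γ w φ} → Valid Γ w →
         Prf C (addC w (node [] (φ ∷ []) []) Γ) → Prf C (addF w (box φ ∷ []) Γ)
  ref  : ∀ {Γ w t} → Valid Γ w →
         Prf C (addF w (neq (tm t) (tm t) ∷ []) Γ) → Prf C Γ
  rep  : ∀ {Γ w t s z N} → Valid Γ w → IsNegLit N →
         Prf C (addF w (neq (tm t) (tm s) ∷ fsub z t N ∷ fsub z s N ∷ []) Γ) →
         Prf C (addF w (neq (tm t) (tm s) ∷ fsub z t N ∷ []) Γ)
  drep : ∀ {Γ w t s} → Valid Γ w →
         Prf C (addT w s (addT w t (addF w (neq (tm t) (tm s) ∷ []) Γ))) →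
         Prf C (addT w t (addF w (neq (tm t) (tm s) ∷ []) Γ))
  rig  : ∀ {Γ w u s t} → Valid Γ w → Valid Γ u → w ≢ u →
         Prf C (addF u (neq (tm s) (tm t) ∷ []) (addF w (neq (tm s) (tm t) ∷ []) Γ)) →
         Prf C (addF w (neq (tm s) (tm t) ∷ []) Γ)
  dp-id : ∀ {Γ w u t} → C ID → ¬ C DD → Valid Γ w → Valid Γ u → w ≢ u →
          Reach (S4 ∪P SG C) cf Γ w u →
          Prf C (addT u t (addT w t Γ)) → Prf C (addT w t Γ)
  dp-dd : ∀ {Γ w u t} → C DD → ¬ C ID → Valid Γ w → Valid Γ u → w ≢ u →
          Reach (S4 ∪P SG C) cb Γ w u →
          Prf C (addT u t (addT w t Γ)) → Prf C (addT w t Γ)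
  dp-both : ∀ {Γ w u t} → C ID → C DD → Valid Γ w → Valid Γ u → w ≢ u →
          Reach S5 cf Γ w u →
          Prf C (addT u t (addT w t Γ)) → Prf C (addT w t Γ)
  rd   : ∀ {Γ w} → C D → Valid Γ w →
         Prf C (addC w (node [] [] []) Γ) → Prf C Γ
  rnd  : ∀ {Γ w y} → C NE → Valid Γ w → ¬ Occ y Γ →
         Prf C (addT w (var y) Γ) → Prf C Γ
  rcd  : ∀ {Γ w t} → C CD → Valid Γ w →
         Prf C (addT w t Γ) → Prf C Γ

-- Both claims are proved at an arbitrary component w of an arbitrary nested
-- sequent, with arbitrary side terms, formulas and children there, and the
-- replacement claim by induction on the size of φ.  For a negative literal N,
-- (rep) adds N(s) next to N(t), closing against N̄(s) by (ax); a positive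
-- literal needs the converse, so s ≠ t is first derived from t ≠ s by (ref) and
-- (rep) applied to x ≠ t for a variable x not in t.  Each logical connective of
-- φ(t) meets its dual in φ̄(s): ∨/∧ split into the two induction hypotheses, ∃/∀
-- share one eigenvariable, chosen fresh and different from z so that
-- substitution for z commutes with instantiating it, and □/◇ open a child into
-- which ◇ propagates along the edge f and (rig) copies t ≠ s.

module Submission where

open import Defs
open import Data.List using (List; []; _∷_; _++_; map)
open import Data.List.Properties using (++-assoc; ++-identityʳ; ++-identityʳ-unique)
open import Data.List.Relation.Unary.Any using (Any; here; there)
open import Data.List.Relation.Binary.Pointwise.Base using (Pointwise; []; _∷_)
open import Data.List.Relation.Binary.Permutation.Propositional
  using (_↭_; ↭-refl; ↭-prep; ↭-swap; ↭-trans; ↭-sym)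
open import Data.List.Relation.Binary.Permutation.Propositional.Properties using (++⁺ʳ; shift; shifts)
import Data.List.Relation.Binary.Permutation.Homogeneous as Homogeneous
open import Data.Nat using (ℕ; zero; suc; _+_; _<_; _≤_; s≤s; _≟_)
open import Data.Nat.ListAction using (sum)
open import Data.Nat.Properties
  using (m≤m+n; m≤n+m; m≤n⇒m≤n+o; m≤n⇒m≤o+n; <⇒≱; m+1+n≢n; n≮n; ≤-refl; ≤-trans)
open import Data.Fin using (Fin; zero; suc)
open import Data.Product using (_×_; _,_)
open import Data.Sum using (inj₁; inj₂)
open import Data.Empty using (⊥-elim)
open import Function using (_∘_)
open import Relation.Nullary using (¬_; yes; no)
open import Relation.Binary.PropositionalEquality
  using (_≡_; _≢_; refl; sym; trans; cong; cong₂; subst; subst₂)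
open import Relation.Binary.Construct.Closure.ReflexiveTransitive using (ε)

mutual
  ≈-refl : ∀ {Γ} → Γ ≈ Γ
  ≈-refl {node ts fs cs} = node ↭-refl ↭-refl (Homogeneous.refl ≋-refl)

  ≋-refl : ∀ {cs} → Pointwise _≈_ cs cs
  ≋-refl {[]} = []
  ≋-refl {c ∷ cs} = ≈-refl ∷ ≋-refl

mutual
  modAt-cong : ∀ p {f g : NSeq → NSeq} → (∀ Δ → f Δ ≡ g Δ) → ∀ Γ → modAt p f Γ ≡ modAt p g Γ
  modAt-cong [] f≡g Γ = f≡g Γ
  modAt-cong (i ∷ p) f≡g (node ts fs cs) = cong (node ts fs) (modIn-cong i p f≡g cs)

  modIn-cong : ∀ i p {f g : NSeq → NSeq} → (∀ Δ → f Δ ≡ g Δ) → ∀ cs → modIn i p f cs ≡ modIn i p g cs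
  modIn-cong i p f≡g [] = refl
  modIn-cong zero p f≡g (c ∷ cs) = cong (_∷ cs) (modAt-cong p f≡g c)
  modIn-cong (suc i) p f≡g (c ∷ cs) = cong (c ∷_) (modIn-cong i p f≡g cs)

mutual
  modAt-cong-≈ : ∀ p {f g : NSeq → NSeq} → (∀ Δ → f Δ ≈ g Δ) → ∀ Γ → modAt p f Γ ≈ modAt p g Γ
  modAt-cong-≈ [] f≈g Γ = f≈g Γ
  modAt-cong-≈ (i ∷ p) f≈g (node ts fs cs) = node ↭-refl ↭-refl (Homogeneous.refl (modIn-cong-≈ i p f≈g cs))

  modIn-cong-≈ : ∀ i p {f g : NSeq → NSeq} → (∀ Δ → f Δ ≈ g Δ) → ∀ cs →
                 Pointwise _≈_ (modIn i p f cs) (modIn i p g cs)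
  modIn-cong-≈ i p f≈g [] = []
  modIn-cong-≈ zero p f≈g (c ∷ cs) = modAt-cong-≈ p f≈g c ∷ ≋-refl
  modIn-cong-≈ (suc i) p f≈g (c ∷ cs) = ≈-refl ∷ modIn-cong-≈ i p f≈g cs

mutual
  modAt-++ : ∀ p q {f g : NSeq → NSeq} Γ → modAt (p ++ q) g (modAt p f Γ) ≡ modAt p (modAt q g ∘ f) Γ
  modAt-++ [] q Γ = refl
  modAt-++ (i ∷ p) q (node ts fs cs) = cong (node ts fs) (modIn-++ i p q cs)

  modIn-++ : ∀ i p q {f g : NSeq → NSeq} cs → modIn i (p ++ q) g (modIn i p f cs) ≡ modIn i p (modAt q g ∘ f) cs
  modIn-++ i p q [] = refl
  modIn-++ zero p q (c ∷ cs) = cong (_∷ cs) (modAt-++ p q c)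
  modIn-++ (suc i) p q (c ∷ cs) = cong (c ∷_) (modIn-++ i p q cs)

modAt-∘ : ∀ p {f g : NSeq → NSeq} Γ → modAt p g (modAt p f Γ) ≡ modAt p (g ∘ f) Γ
modAt-∘ p {f} {g} Γ =
  subst (λ p′ → modAt p′ g (modAt p f Γ) ≡ modAt p (g ∘ f) Γ) (++-identityʳ p) (modAt-++ p [] Γ)

mutual
  modAt-Valid : ∀ {Γ p} {f : NSeq → NSeq} → Valid Γ p → Valid (modAt p f Γ) p
  modAt-Valid here = here
  modAt-Valid (there v) = there (modIn-ValidIn v)

  modIn-ValidIn : ∀ {cs i p} {f : NSeq → NSeq} → ValidIn cs i p → ValidIn (modIn i p f cs) i p
  modIn-ValidIn (vzero v) = vzero (modAt-Valid v)
  modIn-ValidIn (vsuc v) = vsuc (modIn-ValidIn v)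

mutual
  modAt-Valid-++ : ∀ {Γ p q} {f : NSeq → NSeq} → Valid Γ p → (∀ Δ → Valid (f Δ) q) → Valid (modAt p f Γ) (p ++ q)
  modAt-Valid-++ {Γ} here vf = vf Γ
  modAt-Valid-++ (there v) vf = there (modIn-ValidIn-++ v vf)

  modIn-ValidIn-++ : ∀ {cs i p q} {f : NSeq → NSeq} → ValidIn cs i p → (∀ Δ → Valid (f Δ) q) →
                     ValidIn (modIn i p f cs) i (p ++ q)
  modIn-ValidIn-++ (vzero v) vf = vzero (modAt-Valid-++ v vf)
  modIn-ValidIn-++ (vsuc v) vf = vsuc (modIn-ValidIn-++ v vf)

parent≢child : ∀ (p : Path) {i} → p ≢ p ++ i ∷ []
parent≢child p p≡p++i with () ← ++-identityʳ-unique p p≡p++i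

-- Fresh variables

varBoundTerm : Term → ℕ
varBoundTerm (var x) = suc x
varBoundTerm (con _) = 0

varBoundTm : ∀ {n} → Tm n → ℕ
varBoundTm (bnd _) = 0
varBoundTm (tm t) = varBoundTerm t

varBoundF : ∀ {n} → Formula n → ℕ
varBoundF (atom P ts) = sum (map varBoundTm ts)
varBoundF (natom P ts) = sum (map varBoundTm ts)
varBoundF (eq t s) = varBoundTm t + varBoundTm s
varBoundF (neq t s) = varBoundTm t + varBoundTm s
varBoundF (or φ ψ) = varBoundF φ + varBoundF ψ
varBoundF (and φ ψ) = varBoundF φ + varBoundF ψ
varBoundF (ex φ) = varBoundF φ
varBoundF (all φ) = varBoundF φ
varBoundF (dia φ) = varBoundF φ
varBoundF (box φ) = varBoundF φ

mutual
  varBound : NSeq → ℕ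
  varBound (node ts fs cs) = sum (map varBoundTerm ts) + (sum (map varBoundF fs) + varBoundForest cs)

  varBoundForest : List NSeq → ℕ
  varBoundForest [] = 0
  varBoundForest (c ∷ cs) = varBound c + varBoundForest cs

<-+ˡ : ∀ {y} m n → y < m → y < m + n
<-+ˡ m n = m≤n⇒m≤n+o n

<-+ʳ : ∀ {y} m n → y < n → y < m + n
<-+ʳ m n = m≤n⇒m≤o+n m

Any-<-sum : ∀ {A : Set} {P : A → Set} (bound : A → ℕ) {y} → (∀ {x} → P x → y < bound x) →
            ∀ {xs} → Any P xs → y < sum (map bound xs)
Any-<-sum bound below {x ∷ xs} (here p) = <-+ˡ (bound x) _ (below p)
Any-<-sum bound below {x ∷ xs} (there p) = <-+ʳ (bound x) _ (Any-<-sum bound below p)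

OccTerm⇒<varBound : ∀ {y} t → OccTerm y t → y < varBoundTerm t
OccTerm⇒<varBound (var x) refl = ≤-refl

OccTm⇒<varBound : ∀ {n y} (t : Tm n) → OccTm y t → y < varBoundTm t
OccTm⇒<varBound (tm t) o = OccTerm⇒<varBound t o

OccF⇒<varBound : ∀ {n y} (φ : Formula n) → OccF y φ → y < varBoundF φ
OccF⇒<varBound (atom P ts) o = Any-<-sum varBoundTm (λ {t} → OccTm⇒<varBound t) o
OccF⇒<varBound (natom P ts) o = Any-<-sum varBoundTm (λ {t} → OccTm⇒<varBound t) o
OccF⇒<varBound (eq t s) (inj₁ o) = <-+ˡ (varBoundTm t) _ (OccTm⇒<varBound t o)
OccF⇒<varBound (eq t s) (inj₂ o) = <-+ʳ (varBoundTm t) _ (OccTm⇒<varBound s o)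
OccF⇒<varBound (neq t s) (inj₁ o) = <-+ˡ (varBoundTm t) _ (OccTm⇒<varBound t o)
OccF⇒<varBound (neq t s) (inj₂ o) = <-+ʳ (varBoundTm t) _ (OccTm⇒<varBound s o)
OccF⇒<varBound (or φ ψ) (inj₁ o) = <-+ˡ (varBoundF φ) _ (OccF⇒<varBound φ o)
OccF⇒<varBound (or φ ψ) (inj₂ o) = <-+ʳ (varBoundF φ) _ (OccF⇒<varBound ψ o)
OccF⇒<varBound (and φ ψ) (inj₁ o) = <-+ˡ (varBoundF φ) _ (OccF⇒<varBound φ o)
OccF⇒<varBound (and φ ψ) (inj₂ o) = <-+ʳ (varBoundF φ) _ (OccF⇒<varBound ψ o)
OccF⇒<varBound (ex φ) o = OccF⇒<varBound φ o
OccF⇒<varBound (all φ) o = OccF⇒<varBound φ o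
OccF⇒<varBound (dia φ) o = OccF⇒<varBound φ o
OccF⇒<varBound (box φ) o = OccF⇒<varBound φ o

mutual
  Occ⇒<varBound : ∀ {y} Γ → Occ y Γ → y < varBound Γ
  Occ⇒<varBound (node ts fs cs) (occ-sig o) =
    <-+ˡ (sum (map varBoundTerm ts)) _ (Any-<-sum varBoundTerm (λ {t} → OccTerm⇒<varBound t) o)
  Occ⇒<varBound (node ts fs cs) (occ-fml o) =
    <-+ʳ (sum (map varBoundTerm ts)) _
      (<-+ˡ (sum (map varBoundF fs)) _ (Any-<-sum varBoundF (λ {φ} → OccF⇒<varBound φ) o))
  Occ⇒<varBound (node ts fs cs) (occ-sub o) =
    <-+ʳ (sum (map varBoundTerm ts)) _ (<-+ʳ (sum (map varBoundF fs)) _ (Occ⇒<varBoundForest cs o))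

  Occ⇒<varBoundForest : ∀ {y} cs → Any (Occ y) cs → y < varBoundForest cs
  Occ⇒<varBoundForest (c ∷ cs) (here o) = <-+ˡ (varBound c) _ (Occ⇒<varBound c o)
  Occ⇒<varBoundForest (c ∷ cs) (there o) = <-+ʳ (varBound c) _ (Occ⇒<varBoundForest cs o)

varBound+-fresh : ∀ Γ k → ¬ Occ (varBound Γ + k) Γ
varBound+-fresh Γ k o = <⇒≱ (Occ⇒<varBound Γ o) (m≤m+n (varBound Γ) k)

size : ∀ {n} → Formula n → ℕ
size (atom _ _) = 1
size (natom _ _) = 1
size (eq _ _) = 1
size (neq _ _) = 1
size (or φ ψ) = suc (size φ + size ψ)
size (and φ ψ) = suc (size φ + size ψ)
size (ex φ) = suc (size φ)
size (all φ) = suc (size φ)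
size (dia φ) = suc (size φ)
size (box φ) = suc (size φ)

size-subB : ∀ {m n} (σ : Fin m → Tm n) φ → size (subB σ φ) ≡ size φ
size-subB σ (atom _ _) = refl
size-subB σ (natom _ _) = refl
size-subB σ (eq _ _) = refl
size-subB σ (neq _ _) = refl
size-subB σ (or φ ψ) = cong suc (cong₂ _+_ (size-subB σ φ) (size-subB σ ψ))
size-subB σ (and φ ψ) = cong suc (cong₂ _+_ (size-subB σ φ) (size-subB σ ψ))
size-subB σ (ex φ) = cong suc (size-subB (ext σ) φ)
size-subB σ (all φ) = cong suc (size-subB (ext σ) φ)
size-subB σ (dia φ) = cong suc (size-subB σ φ)
size-subB σ (box φ) = cong suc (size-subB σ φ)

size-<ˡ : ∀ {m n k} → suc (m + n) ≤ k → m < k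
size-<ˡ {m} {n} h = ≤-trans (s≤s (m≤m+n m n)) h

size-<ʳ : ∀ {m n k} → suc (m + n) ≤ k → n < k
size-<ʳ {m} {n} h = ≤-trans (s≤s (m≤n+m n m)) h

size-inst-< : ∀ {k t} (ψ : Formula 1) → size ψ < k → size (inst ψ t) < k
size-inst-< {k} ψ h = subst (_< k) (sym (size-subB _ ψ)) h

neg-subB : ∀ {m n} (σ : Fin m → Tm n) φ → neg (subB σ φ) ≡ subB σ (neg φ)
neg-subB σ (atom _ _) = refl
neg-subB σ (natom _ _) = refl
neg-subB σ (eq _ _) = refl
neg-subB σ (neq _ _) = refl
neg-subB σ (or φ ψ) = cong₂ and (neg-subB σ φ) (neg-subB σ ψ)
neg-subB σ (and φ ψ) = cong₂ or (neg-subB σ φ) (neg-subB σ ψ)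
neg-subB σ (ex φ) = cong all (neg-subB (ext σ) φ)
neg-subB σ (all φ) = cong ex (neg-subB (ext σ) φ)
neg-subB σ (dia φ) = cong box (neg-subB σ φ)
neg-subB σ (box φ) = cong dia (neg-subB σ φ)

module _ {m n} {σ τ : Fin m → Tm n} (σ≗τ : ∀ i → σ i ≡ τ i) where
  subTm-cong : ∀ t → subTm σ t ≡ subTm τ t
  subTm-cong (bnd i) = σ≗τ i
  subTm-cong (tm t) = refl

  subTms-cong : ∀ ts → subTms σ ts ≡ subTms τ ts
  subTms-cong [] = refl
  subTms-cong (t ∷ ts) = cong₂ _∷_ (subTm-cong t) (subTms-cong ts)

  ext-cong : ∀ i → ext σ i ≡ ext τ i
  ext-cong zero = refl
  ext-cong (suc i) = cong wkTm (σ≗τ i)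

subB-cong : ∀ {m n} {σ τ : Fin m → Tm n} → (∀ i → σ i ≡ τ i) → ∀ φ → subB σ φ ≡ subB τ φ
subB-cong σ≗τ (atom P ts) = cong (atom P) (subTms-cong σ≗τ ts)
subB-cong σ≗τ (natom P ts) = cong (natom P) (subTms-cong σ≗τ ts)
subB-cong σ≗τ (eq t s) = cong₂ eq (subTm-cong σ≗τ t) (subTm-cong σ≗τ s)
subB-cong σ≗τ (neq t s) = cong₂ neq (subTm-cong σ≗τ t) (subTm-cong σ≗τ s)
subB-cong σ≗τ (or φ ψ) = cong₂ or (subB-cong σ≗τ φ) (subB-cong σ≗τ ψ)
subB-cong σ≗τ (and φ ψ) = cong₂ and (subB-cong σ≗τ φ) (subB-cong σ≗τ ψ)
subB-cong σ≗τ (ex φ) = cong ex (subB-cong (ext-cong σ≗τ) φ)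
subB-cong σ≗τ (all φ) = cong all (subB-cong (ext-cong σ≗τ) φ)
subB-cong σ≗τ (dia φ) = cong dia (subB-cong σ≗τ φ)
subB-cong σ≗τ (box φ) = cong box (subB-cong σ≗τ φ)

module _ (z : ℕ) (u : Term) where
  fsubTm-var-self : ∀ {n} → fsubTm {n} z u (tm (var z)) ≡ tm u
  fsubTm-var-self with z ≟ z
  ... | yes _ = refl
  ... | no z≢z = ⊥-elim (z≢z refl)

  fsubTm-var-other : ∀ {n} y → y ≢ z → fsubTm {n} z u (tm (var y)) ≡ tm (var y)
  fsubTm-var-other y y≢z with y ≟ z
  ... | yes y≡z = ⊥-elim (y≢z y≡z)
  ... | no _ = refl

  fsubTm-fresh : ∀ {n} v → ¬ OccTerm z v → fsubTm {n} z u (tm v) ≡ tm v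
  fsubTm-fresh (var y) z∉v = fsubTm-var-other y z∉v
  fsubTm-fresh (con c) _ = refl

  fsubTm-wkTm : ∀ {n} (a : Tm n) → fsubTm z u (wkTm a) ≡ wkTm (fsubTm z u a)
  fsubTm-wkTm (bnd i) = refl
  fsubTm-wkTm (tm (var y)) with y ≟ z
  ... | yes _ = refl
  ... | no _ = refl
  fsubTm-wkTm (tm (con c)) = refl

  module _ {m n} (σ : Fin m → Tm n) where
    σ[u/z] : Fin m → Tm n
    σ[u/z] i = fsubTm z u (σ i)

    fsubTm-subTm : ∀ a → fsubTm z u (subTm σ a) ≡ subTm σ[u/z] (fsubTm z u a)
    fsubTm-subTm (bnd i) = refl
    fsubTm-subTm (tm (var y)) with y ≟ z
    ... | yes _ = refl
    ... | no _ = refl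
    fsubTm-subTm (tm (con c)) = refl

    fsubTms-subTms : ∀ ts → fsubTms z u (subTms σ ts) ≡ subTms σ[u/z] (fsubTms z u ts)
    fsubTms-subTms [] = refl
    fsubTms-subTms (a ∷ ts) = cong₂ _∷_ (fsubTm-subTm a) (fsubTms-subTms ts)

    fsubTm-ext : ∀ i → fsubTm z u (ext σ i) ≡ ext σ[u/z] i
    fsubTm-ext zero = refl
    fsubTm-ext (suc i) = fsubTm-wkTm (σ i)

  fsub-subB : ∀ {m n} (σ : Fin m → Tm n) φ → fsub z u (subB σ φ) ≡ subB (σ[u/z] σ) (fsub z u φ)
  fsub-subB σ (atom P ts) = cong (atom P) (fsubTms-subTms σ ts)
  fsub-subB σ (natom P ts) = cong (natom P) (fsubTms-subTms σ ts)
  fsub-subB σ (eq a c) = cong₂ eq (fsubTm-subTm σ a) (fsubTm-subTm σ c)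
  fsub-subB σ (neq a c) = cong₂ neq (fsubTm-subTm σ a) (fsubTm-subTm σ c)
  fsub-subB σ (or φ ψ) = cong₂ or (fsub-subB σ φ) (fsub-subB σ ψ)
  fsub-subB σ (and φ ψ) = cong₂ and (fsub-subB σ φ) (fsub-subB σ ψ)
  fsub-subB σ (ex φ) = cong ex (trans (fsub-subB (ext σ) φ) (subB-cong (fsubTm-ext σ) (fsub z u φ)))
  fsub-subB σ (all φ) = cong all (trans (fsub-subB (ext σ) φ) (subB-cong (fsubTm-ext σ) (fsub z u φ)))
  fsub-subB σ (dia φ) = cong dia (fsub-subB σ φ)
  fsub-subB σ (box φ) = cong box (fsub-subB σ φ)

  fsub-inst : ∀ y → y ≢ z → (ψ : Formula 1) → fsub z u (inst ψ (var y)) ≡ inst (fsub z u ψ) (var y)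
  fsub-inst y y≢z ψ = trans (fsub-subB _ ψ) (subB-cong (λ { zero → fsubTm-var-other y y≢z }) (fsub z u ψ))

  fsub-IsLit : ∀ {n} {N : Formula n} → IsNegLit N → IsLit (fsub z u N)
  fsub-IsLit (nlit-natom P ts) = lit-natom _ _
  fsub-IsLit (nlit-neq t s) = lit-neq _ _

-- Rules applied at a fixed component

_≠_ : Term → Term → Fml
t ≠ s = neq (tm t) (tm s)

prepend : List Term → List Fml → List NSeq → NSeq → NSeq
prepend a b c (node ts fs cs) = node (a ++ ts) (b ++ fs) (c ++ cs)

module Focus (C : CondSet) {Γ : NSeq} {w : Path} (v : Valid Γ w) where

  ⟪_∣_∣_⟫ : List Term → List Fml → List NSeq → NSeq
  ⟪ a ∣ b ∣ c ⟫ = modAt w (prepend a b c) Γ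

  child : Path
  child = w ++ 0 ∷ []

  addF-empty : ∀ φs → addF w φs Γ ≡ ⟪ [] ∣ φs ∣ [] ⟫
  addF-empty φs = modAt-cong w (λ { (node ts fs cs) → refl }) Γ

  addF-⟪⟫ : ∀ φs a b c → addF w φs ⟪ a ∣ b ∣ c ⟫ ≡ ⟪ a ∣ φs ++ b ∣ c ⟫
  addF-⟪⟫ φs a b c = trans (modAt-∘ w Γ) (modAt-cong w (λ { (node ts fs cs) →
    cong (λ fs′ → node (a ++ ts) fs′ (c ++ cs)) (sym (++-assoc φs b fs)) }) Γ)

  addT-addF-⟪⟫ : ∀ t φs a b c → addT w t (addF w φs ⟪ a ∣ b ∣ c ⟫) ≡ ⟪ t ∷ a ∣ φs ++ b ∣ c ⟫
  addT-addF-⟪⟫ t φs a b c =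
    trans (cong (addT w t) (addF-⟪⟫ φs a b c)) (trans (modAt-∘ w Γ) (modAt-cong w (λ { (node ts fs cs) → refl }) Γ))

  addC-⟪⟫ : ∀ H a b c → addC w H ⟪ a ∣ b ∣ c ⟫ ≡ ⟪ a ∣ b ∣ H ∷ c ⟫
  addC-⟪⟫ H a b c = trans (modAt-∘ w Γ) (modAt-cong w (λ { (node ts fs cs) → refl }) Γ)

  addF-child-⟪⟫ : ∀ φs a b hs gs ds c →
                  addF child φs ⟪ a ∣ b ∣ node hs gs ds ∷ c ⟫ ≡ ⟪ a ∣ b ∣ node hs (φs ++ gs) ds ∷ c ⟫
  addF-child-⟪⟫ φs a b hs gs ds c =
    trans (modAt-++ w (0 ∷ []) Γ) (modAt-cong w (λ { (node ts fs cs) → refl }) Γ)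

  addF-child-addF-⟪⟫ : ∀ φs ψs a b hs gs ds c →
                       addF child φs (addF w ψs ⟪ a ∣ b ∣ node hs gs ds ∷ c ⟫)
                         ≡ ⟪ a ∣ ψs ++ b ∣ node hs (φs ++ gs) ds ∷ c ⟫
  addF-child-addF-⟪⟫ φs ψs a b hs gs ds c =
    trans (cong (addF child φs) (addF-⟪⟫ ψs a b _)) (addF-child-⟪⟫ φs a _ hs gs ds c)

  valid-focus : ∀ {a b c} → Valid ⟪ a ∣ b ∣ c ⟫ w
  valid-focus = modAt-Valid v

  valid-child : ∀ {a b hs gs ds c} → Valid ⟪ a ∣ b ∣ node hs gs ds ∷ c ⟫ child
  valid-child = modAt-Valid-++ v λ { (node _ _ _) → there (vzero here) }

  private
    cast : ∀ {Δ Δ′} → Δ ≡ Δ′ → Prf C Δ → Prf C Δ′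
    cast = subst (Prf C)

  exchange : ∀ {a b b′ c} → b ↭ b′ → Prf C ⟪ a ∣ b′ ∣ c ⟫ → Prf C ⟪ a ∣ b ∣ c ⟫
  exchange b↭b′ = perm (modAt-cong-≈ w (λ { (node ts fs cs) →
    node ↭-refl (++⁺ʳ fs b↭b′) (Homogeneous.refl ≋-refl) }) Γ)

  exchange-child : ∀ {a b hs gs gs′ ds c} → gs ↭ gs′ →
                   Prf C ⟪ a ∣ b ∣ node hs gs′ ds ∷ c ⟫ → Prf C ⟪ a ∣ b ∣ node hs gs ds ∷ c ⟫
  exchange-child gs↭gs′ = perm (modAt-cong-≈ w (λ { (node ts fs cs) →
    node ↭-refl ↭-refl
      (Homogeneous.prep (node ↭-refl gs↭gs′ (Homogeneous.refl ≋-refl)) (Homogeneous.refl ≋-refl)) }) Γ)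

  ax-focus : ∀ {a b c L} → IsLit L → Prf C ⟪ a ∣ L ∷ neg L ∷ b ∣ c ⟫
  ax-focus {a} {b} {c} l = cast (addF-⟪⟫ _ a b c) (ax {Γ = ⟪ a ∣ b ∣ c ⟫} valid-focus l)

  ∨-focus : ∀ {a b c φ ψ} → Prf C ⟪ a ∣ φ ∷ ψ ∷ b ∣ c ⟫ → Prf C ⟪ a ∣ or φ ψ ∷ b ∣ c ⟫
  ∨-focus {a} {b} {c} p =
    cast (addF-⟪⟫ _ a b c) (r∨ {Γ = ⟪ a ∣ b ∣ c ⟫} valid-focus (cast (sym (addF-⟪⟫ _ a b c)) p))

  ∧-focus : ∀ {a b c φ ψ} → Prf C ⟪ a ∣ φ ∷ b ∣ c ⟫ → Prf C ⟪ a ∣ ψ ∷ b ∣ c ⟫ → Prf C ⟪ a ∣ and φ ψ ∷ b ∣ c ⟫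
  ∧-focus {a} {b} {c} p q =
    cast (addF-⟪⟫ _ a b c)
      (r∧ {Γ = ⟪ a ∣ b ∣ c ⟫} valid-focus (cast (sym (addF-⟪⟫ _ a b c)) p) (cast (sym (addF-⟪⟫ _ a b c)) q))

  ∃-focus : ∀ {a b c ψ t} → Prf C ⟪ t ∷ a ∣ ex ψ ∷ inst ψ t ∷ b ∣ c ⟫ → Prf C ⟪ t ∷ a ∣ ex ψ ∷ b ∣ c ⟫
  ∃-focus {a} {b} {c} {ψ} {t} p =
    cast (addT-addF-⟪⟫ t _ a b c)
      (r∃ {Γ = ⟪ a ∣ b ∣ c ⟫} {t = t} {ψ = ψ} valid-focus (cast (sym (addT-addF-⟪⟫ t _ a b c)) p))

  ∀-focus : ∀ {a b c φ} y → ¬ Occ y ⟪ a ∣ all φ ∷ b ∣ c ⟫ →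
            Prf C ⟪ var y ∷ a ∣ inst φ (var y) ∷ b ∣ c ⟫ → Prf C ⟪ a ∣ all φ ∷ b ∣ c ⟫
  ∀-focus {a} {b} {c} {φ} y y-fresh p =
    cast (addF-⟪⟫ _ a b c)
      (r∀ {Γ = ⟪ a ∣ b ∣ c ⟫} {y = y} {φ = φ} valid-focus (y-fresh ∘ subst (Occ y) (addF-⟪⟫ _ a b c))
        (cast (sym (addT-addF-⟪⟫ (var y) _ a b c)) p))

  □-focus : ∀ {a b c φ} → Prf C ⟪ a ∣ b ∣ node [] (φ ∷ []) [] ∷ c ⟫ → Prf C ⟪ a ∣ box φ ∷ b ∣ c ⟫
  □-focus {a} {b} {c} p =
    cast (addF-⟪⟫ _ a b c) (r□ {Γ = ⟪ a ∣ b ∣ c ⟫} valid-focus (cast (sym (addC-⟪⟫ _ a b c)) p))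

  -- f ∈ L(f) by the empty derivation, and f leads from a component to its child.
  ◇-child : ∀ {a b hs gs ds c φ} →
            Prf C ⟪ a ∣ dia φ ∷ b ∣ node hs (φ ∷ gs) ds ∷ c ⟫ → Prf C ⟪ a ∣ dia φ ∷ b ∣ node hs gs ds ∷ c ⟫
  ◇-child {a} {b} {hs} {gs} {ds} {c} {φ} p =
    cast (addF-⟪⟫ _ a b _)
      (r◇ {Γ = ⟪ a ∣ b ∣ node hs gs ds ∷ c ⟫} {φ = φ} valid-focus valid-child
        (cf ∷ [] , ε , pf refl valid-child pnil) (cast (sym (addF-child-addF-⟪⟫ _ _ a b hs gs ds c)) p))

  rig-child : ∀ {a b hs gs ds c t s} →
              Prf C ⟪ a ∣ t ≠ s ∷ b ∣ node hs (t ≠ s ∷ gs) ds ∷ c ⟫ → Prf C ⟪ a ∣ t ≠ s ∷ b ∣ node hs gs ds ∷ c ⟫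
  rig-child {a} {b} {hs} {gs} {ds} {c} {t} {s} p =
    cast (addF-⟪⟫ _ a b _)
      (rig {Γ = ⟪ a ∣ b ∣ node hs gs ds ∷ c ⟫} {s = t} {t = s} valid-focus valid-child (parent≢child w)
        (cast (sym (addF-child-addF-⟪⟫ _ _ a b hs gs ds c)) p))

  ref-focus : ∀ {a b c t} → Prf C ⟪ a ∣ t ≠ t ∷ b ∣ c ⟫ → Prf C ⟪ a ∣ b ∣ c ⟫
  ref-focus {a} {b} {c} {t} p = ref {Γ = ⟪ a ∣ b ∣ c ⟫} {t = t} valid-focus (cast (sym (addF-⟪⟫ _ a b c)) p)

  rep-focus : ∀ {a b c t s} z {N} → IsNegLit N →
              Prf C ⟪ a ∣ t ≠ s ∷ fsub z t N ∷ fsub z s N ∷ b ∣ c ⟫ → Prf C ⟪ a ∣ t ≠ s ∷ fsub z t N ∷ b ∣ c ⟫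
  rep-focus {a} {b} {c} {t} {s} z {N} n p =
    cast (addF-⟪⟫ _ a b c)
      (rep {Γ = ⟪ a ∣ b ∣ c ⟫} {t = t} {s = s} {z = z} {N = N} valid-focus n (cast (sym (addF-⟪⟫ _ a b c)) p))

  ≠-sym : ∀ {a b c t s} → Prf C ⟪ a ∣ t ≠ s ∷ t ≠ t ∷ s ≠ t ∷ b ∣ c ⟫ → Prf C ⟪ a ∣ t ≠ s ∷ b ∣ c ⟫
  ≠-sym {a} {b} {c} {t} {s} p =
    ref-focus (exchange (↭-swap _ _ ↭-refl)
      (subst (λ A → Prf C ⟪ a ∣ t ≠ s ∷ A ∷ b ∣ c ⟫) N[t/x]
        (rep-focus x (nlit-neq (tm (var x)) (tm t))
          (subst₂ (λ A B → Prf C ⟪ a ∣ t ≠ s ∷ A ∷ B ∷ b ∣ c ⟫) (sym N[t/x]) (sym N[s/x]) p))))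
    where
    x : ℕ
    x = varBoundTerm t
    x∉t : ¬ OccTerm x t
    x∉t = n≮n x ∘ OccTerm⇒<varBound t
    N[t/x] : fsub x t (neq (tm (var x)) (tm t)) ≡ t ≠ t
    N[t/x] = cong₂ neq (fsubTm-var-self x t) (fsubTm-fresh x t t x∉t)
    N[s/x] : fsub x s (neq (tm (var x)) (tm t)) ≡ s ≠ t
    N[s/x] = cong₂ neq (fsubTm-var-self x s) (fsubTm-fresh x s t x∉t)

  =-refl-focus : ∀ {a b c t} → Prf C ⟪ a ∣ eq (tm t) (tm t) ∷ b ∣ c ⟫
  =-refl-focus {t = t} = ref-focus {t = t} (exchange (↭-swap _ _ ↭-refl) (ax-focus (lit-eq _ _)))

  negLit-replacement : ∀ {a b c t s} z {N} → IsNegLit N →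
                       Prf C ⟪ a ∣ t ≠ s ∷ fsub z t N ∷ neg (fsub z s N) ∷ b ∣ c ⟫
  negLit-replacement z n =
    rep-focus z n (exchange (shifts (_ ∷ _ ∷ []) (_ ∷ _ ∷ [])) (ax-focus (fsub-IsLit z _ n)))

  posLit-replacement : ∀ {a b c t s} z {N} → IsNegLit N →
                       Prf C ⟪ a ∣ t ≠ s ∷ neg (fsub z t N) ∷ fsub z s N ∷ b ∣ c ⟫
  posLit-replacement z n =
    ≠-sym (exchange (↭-trans (shifts (_ ∷ _ ∷ []) (_ ∷ _ ∷ _ ∷ [])) (↭-prep _ (↭-swap _ _ ↭-refl)))
      (negLit-replacement z n))

  ∨∧-focus : ∀ {a b c x α β α′ β′} →
             Prf C ⟪ a ∣ x ∷ α ∷ α′ ∷ β ∷ b ∣ c ⟫ → Prf C ⟪ a ∣ x ∷ β ∷ β′ ∷ α ∷ b ∣ c ⟫ →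
             Prf C ⟪ a ∣ x ∷ or α β ∷ and α′ β′ ∷ b ∣ c ⟫
  ∨∧-focus p q =
    exchange (↭-swap _ _ ↭-refl) (∨-focus (exchange (shift _ (_ ∷ _ ∷ _ ∷ []) _) (∧-focus
      (exchange (↭-trans (shift _ (_ ∷ _ ∷ _ ∷ []) _) (↭-prep _ (↭-swap _ _ ↭-refl))) p)
      (exchange (↭-trans (shift _ (_ ∷ _ ∷ _ ∷ []) _) (↭-prep _ (shift _ (_ ∷ _ ∷ []) _))) q))))

  ∧∨-focus : ∀ {a b c x α β α′ β′} →
             Prf C ⟪ a ∣ x ∷ α ∷ α′ ∷ β′ ∷ b ∣ c ⟫ → Prf C ⟪ a ∣ x ∷ β ∷ β′ ∷ α′ ∷ b ∣ c ⟫ →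
             Prf C ⟪ a ∣ x ∷ and α β ∷ or α′ β′ ∷ b ∣ c ⟫
  ∧∨-focus p q =
    exchange (↭-swap _ _ ↭-refl) (∧-focus
      (exchange (shift _ (_ ∷ _ ∷ []) _) (∨-focus
        (exchange (↭-trans (shifts (_ ∷ _ ∷ []) (_ ∷ _ ∷ [])) (↭-swap _ _ ↭-refl)) p)))
      (exchange (shift _ (_ ∷ _ ∷ []) _) (∨-focus
        (exchange (↭-trans (shifts (_ ∷ _ ∷ []) (_ ∷ _ ∷ []))
                    (↭-trans (↭-swap _ _ ↭-refl) (↭-prep _ (↭-prep _ (↭-swap _ _ ↭-refl))))) q))))

  ∃∀-focus : ∀ {a b c x α β} z →
             (∀ y → y ≢ z → Prf C ⟪ var y ∷ a ∣ x ∷ inst α (var y) ∷ inst β (var y) ∷ ex α ∷ b ∣ c ⟫) →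
             Prf C ⟪ a ∣ x ∷ ex α ∷ all β ∷ b ∣ c ⟫
  ∃∀-focus {a} {b} {c} {x} {α} {β} z p =
    exchange (shift _ (_ ∷ _ ∷ []) _) (∀-focus y (varBound+-fresh _ (suc z))
      (exchange (shift _ (_ ∷ _ ∷ []) _) (∃-focus
        (exchange (↭-trans (shift _ (_ ∷ _ ∷ _ ∷ []) _) (↭-prep _ (↭-sym (shift _ (_ ∷ _ ∷ []) _))))
          (p y (m+1+n≢n _))))))
    where
    y : ℕ
    y = varBound ⟪ a ∣ all β ∷ x ∷ ex α ∷ b ∣ c ⟫ + suc z

  ∀∃-focus : ∀ {a b c x α β} z →
             (∀ y → y ≢ z → Prf C ⟪ var y ∷ a ∣ x ∷ inst α (var y) ∷ inst β (var y) ∷ ex β ∷ b ∣ c ⟫) →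
             Prf C ⟪ a ∣ x ∷ all α ∷ ex β ∷ b ∣ c ⟫
  ∀∃-focus {a} {b} {c} {x} {α} {β} z p =
    exchange (↭-swap _ _ ↭-refl) (∀-focus y (varBound+-fresh _ (suc z))
      (exchange (shift _ (_ ∷ _ ∷ []) _) (∃-focus
        (exchange (↭-trans (shift _ (_ ∷ _ ∷ _ ∷ []) _) (↭-prep _ (↭-trans (↭-swap _ _ ↭-refl)
                    (↭-trans (↭-prep _ (↭-swap _ _ ↭-refl)) (↭-swap _ _ ↭-refl)))))
          (p y (m+1+n≢n _))))))
    where
    y : ℕ
    y = varBound ⟪ a ∣ all α ∷ x ∷ ex β ∷ b ∣ c ⟫ + suc z

  ◇□-focus : ∀ {a b c t s α β} →
             Prf C ⟪ a ∣ t ≠ s ∷ dia α ∷ b ∣ node [] (t ≠ s ∷ α ∷ β ∷ []) [] ∷ c ⟫ →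
             Prf C ⟪ a ∣ t ≠ s ∷ dia α ∷ box β ∷ b ∣ c ⟫
  ◇□-focus p =
    exchange (shift _ (_ ∷ _ ∷ []) _)
      (□-focus (exchange (↭-swap _ _ ↭-refl) (◇-child (exchange (↭-swap _ _ ↭-refl) (rig-child p)))))

  □◇-focus : ∀ {a b c t s α β} →
             Prf C ⟪ a ∣ t ≠ s ∷ dia β ∷ b ∣ node [] (t ≠ s ∷ α ∷ β ∷ []) [] ∷ c ⟫ →
             Prf C ⟪ a ∣ t ≠ s ∷ box α ∷ dia β ∷ b ∣ c ⟫
  □◇-focus p =
    exchange (↭-swap _ _ ↭-refl)
      (□-focus (exchange (↭-swap _ _ ↭-refl) (◇-child (exchange (↭-swap _ _ ↭-refl)
        (rig-child (exchange-child (↭-prep _ (↭-swap _ _ ↭-refl)) p))))))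

-- The replacement property

module Replacement (C : CondSet) (z : ℕ) where

  Replaceable : Fml → Set
  Replaceable φ = ∀ t s {Γ w} (v : Valid Γ w) {a b c} →
                  Prf C (Focus.⟪_∣_∣_⟫ C v a (t ≠ s ∷ fsub z t φ ∷ fsub z s (neg φ) ∷ b) c)

  replaceable-child : ∀ {φ} → Replaceable φ → ∀ t s {Γ w} (v : Valid Γ w) {a b c} →
                      Prf C (Focus.⟪_∣_∣_⟫ C v a b (node [] (t ≠ s ∷ fsub z t φ ∷ fsub z s (neg φ) ∷ []) [] ∷ c))
  replaceable-child {φ} ih t s v {a} {b} {c} =
    subst (Prf C) (trans (sym (Child.addF-empty _)) (addF-child-⟪⟫ _ a b [] [] [] c)) (ih t s valid-child)
    where
    open Focus C v
    module Child = Focus C (valid-child {a} {b} {[]} {[]} {[]} {c})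

  replaceable-inst : ∀ (ψ : Formula 1) y → y ≢ z → Replaceable (inst ψ (var y)) →
                     ∀ t s {Γ w} (v : Valid Γ w) {a b c} →
                     Prf C (Focus.⟪_∣_∣_⟫ C v a
                       (t ≠ s ∷ inst (fsub z t ψ) (var y) ∷ inst (fsub z s (neg ψ)) (var y) ∷ b) c)
  replaceable-inst ψ y y≢z ih t s v {a} {b} {c} =
    subst₂ (λ A B → Prf C (Focus.⟪_∣_∣_⟫ C v a (t ≠ s ∷ A ∷ B ∷ b) c))
      (fsub-inst z t y y≢z ψ) (trans (cong (fsub z s) (neg-subB _ ψ)) (fsub-inst z s y y≢z (neg ψ))) (ih t s v)

  replaceable : ∀ k φ → size φ < k → Replaceable φ
  replaceable (suc k) (atom P ts) _ t s v = Focus.posLit-replacement C v z (nlit-natom P ts)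
  replaceable (suc k) (natom P ts) _ t s v = Focus.negLit-replacement C v z (nlit-natom P ts)
  replaceable (suc k) (eq x y) _ t s v = Focus.posLit-replacement C v z (nlit-neq x y)
  replaceable (suc k) (neq x y) _ t s v = Focus.negLit-replacement C v z (nlit-neq x y)
  replaceable (suc k) (or φ ψ) (s≤s h) t s v =
    Focus.∨∧-focus C v (replaceable k φ (size-<ˡ h) t s v) (replaceable k ψ (size-<ʳ h) t s v)
  replaceable (suc k) (and φ ψ) (s≤s h) t s v =
    Focus.∧∨-focus C v (replaceable k φ (size-<ˡ h) t s v) (replaceable k ψ (size-<ʳ h) t s v)
  replaceable (suc k) (ex ψ) (s≤s h) t s v =
    Focus.∃∀-focus C v z λ y y≢z →
      replaceable-inst ψ y y≢z (replaceable k (inst ψ (var y)) (size-inst-< ψ h)) t s v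
  replaceable (suc k) (all ψ) (s≤s h) t s v =
    Focus.∀∃-focus C v z λ y y≢z →
      replaceable-inst ψ y y≢z (replaceable k (inst ψ (var y)) (size-inst-< ψ h)) t s v
  replaceable (suc k) (dia φ) (s≤s h) t s v = Focus.◇□-focus C v (replaceable-child (replaceable k φ h) t s v)
  replaceable (suc k) (box φ) (s≤s h) t s v = Focus.□◇-focus C v (replaceable-child (replaceable k φ h) t s v)

  replacement : ∀ φ → Replaceable φ
  replacement φ = replaceable (suc (size φ)) φ ≤-refl

mainTheorem12 : (C : CondSet) → Closed C →
    (𝒢 : Ctx) (t s : Term) (z : ℕ) (φ : Fml) →
    Prf C (𝒢 ⟦ eq (tm t) (tm t) ∷ [] ⟧) ×
    Prf C (𝒢 ⟦ neq (tm t) (tm s) ∷ fsub z t φ ∷ fsub z s (neg φ) ∷ [] ⟧)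
mainTheorem12 C _ (ctx Γ w v) t s z φ =
  subst (Prf C) (sym (addF-empty _)) =-refl-focus ,
  subst (Prf C) (sym (addF-empty _)) (Replacement.replacement C z φ t s v)
  where
  open Focus C v
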